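{- Let $I=(E,\mathcal{I},c,T)$ be an EMB instance and let $P=(\mathrm{opt},\mathcal{F},\triangleleft)\in\mathcal{Q}$ with $\mathrm{opt}=\min$. Then every solution $S$ of $R_P(I)$ satisfies $v_I(S)\ge k_I\cdot H_I+T$.
   Context: A matroid is a pair $(E,\mathcal{I})$ with $E$ finite, $\emptyset\in\mathcal{I}\subseteq2^E$, closed under subsets, with the exchange property; for $\mathcal{M}=(E,\mathcal{I})$, $\mathrm{IS}(\mathcal{M})=\mathcal{I}$ and $\mathrm{bases}(\mathcal{M})$ is the set of independent sets of maximum cardinality. For a function $f$ on $E$ and $Y\subseteq E$, $f(Y)=\sum_{e\in Y}f(e)$. EMB instance: $(E,\mathcal{I},c,T)$ with $(E,\mathcal{I})$ a matroid, $c:E\to\mathbb{N}$, $T\in\mathbb{N}$. $\mathcal{Q}=\left(\{\max,\min\}\times\{\mathrm{bases},\mathrm{IS}\}\times\{\le,\ge\}\right)\setminus\{(\min,\mathrm{IS},\le)\}$. For $P=(\mathrm{opt},\mathcal{F},\triangleleft)$, a $P$-MOL instance $(E,\mathcal{I},v,w,L)$ (matroid $\mathcal{M}=(E,\mathcal{I})$, $v,w:E\to\mathbb{R}_{\ge0}$, $L\ge0$) has as solutions the sets $S\in\mathcal{F}(\mathcal{M})$ with $w(S)\triangleleft L$. Reduction: $d(P)=0$ if ($\mathrm{opt}=\max$ and $\triangleleft$ is $\le$) or ($\mathrm{opt}=\min$ and $\triangleleft$ is $\ge$), else $d(P)=1$; $H_I=2\max\{1,c(E)\}$; $v_I(e)=H_I+c(e)$;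 $w_{I,P}(e)=H_I+c(e)(-1)^{d(P)}$; $k_I=\max_{S\in\mathcal{I}}|S|$; $L_{I,P}=k_IH_I+T(-1)^{d(P)}$; $R_P(I)=(E,\mathcal{I},v_I,w_{I,P},L_{I,P})$. -}

module Defs where

open import Data.Nat as ℕ using (ℕ; zero; suc; _⊔_; _<_)
open import Data.Integer as ℤ using (ℤ; +_; _-_)
open import Data.Bool using (Bool; true; false)
open import Data.Fin using (Fin; zero; suc)
open import Data.Fin.Subset using (Subset; ⊥; ⁅_⁆; _∈_; _∉_; _⊆_; _∪_; ∣_∣; inside; outside)
open import Data.Vec using (Vec; []; _∷_; replicate)
open import Data.List using (List; []; _∷_; _++_; map; foldr)
open import Data.Product using (Σ; _×_; ∃)
open import Relation.Nullary using (Dec; yes; no; ¬_)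
open import Relation.Binary.PropositionalEquality using (_≡_)

record Matroid (n : ℕ) : Set₁ where
  field
    Indep    : Subset n → Set
    Indep?   : (X : Subset n) → Dec (Indep X)      -- finite ⇒ decidable
    empty    : Indep ⊥
    hered    : ∀ {X Y} → X ⊆ Y → Indep Y → Indep X
    exchange : ∀ {X Y} → Indep X → Indep Y → ∣ X ∣ < ∣ Y ∣ →
               ∃ λ e → e ∈ Y × e ∉ X × Indep (X ∪ ⁅ e ⁆)
open Matroid public

allSubsets : (n : ℕ) → List (Subset n)
allSubsets zero    = [] ∷ []
allSubsets (suc n) = map (inside ∷_) (allSubsets n) ++ map (outside ∷_) (allSubsets n)

rankE : ∀ {n} → Matroid n → ℕ
rankE {n} M = foldr (λ X r → step X r) 0 (allSubsets n)
  where
  step : Subset n → ℕ → ℕ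
  step X r with Indep? M X
  ... | yes _ = ∣ X ∣ ⊔ r
  ... | no  _ = r

IsIndep : ∀ {n} → Matroid n → Subset n → Set
IsIndep M X = Indep M X

IsBase : ∀ {n} → Matroid n → Subset n → Set
IsBase {n} M X = Indep M X × (∀ Y → Indep M Y → ∣ Y ∣ ℕ.≤ ∣ X ∣)

sumℕ : ∀ {n} → (Fin n → ℕ) → Subset n → ℕ
sumℕ f []             = 0
sumℕ f (inside  ∷ Y)  = f zero ℕ.+ sumℕ (λ i → f (suc i)) Y
sumℕ f (outside ∷ Y)  = sumℕ (λ i → f (suc i)) Y

sumℤ : ∀ {n} → (Fin n → ℤ) → Subset n → ℤ
sumℤ f []             = + 0
sumℤ f (inside  ∷ Y)  = f zero ℤ.+ sumℤ (λ i → f (suc i)) Y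
sumℤ f (outside ∷ Y)  = sumℤ (λ i → f (suc i)) Y

full : (n : ℕ) → Subset n
full n = replicate n inside

record EMB (n : ℕ) : Set₁ where
  field
    M : Matroid n
    c : Fin n → ℕ
    T : ℕ
open EMB public

data Opt : Set where
  max min : Opt

data Fam : Set where
  bases IS : Fam

data Rel : Set where
  le ge : Rel

record Problem : Set where
  constructor ⟨_,_,_⟩
  field
    opt : Opt
    fam : Fam
    rel : Rel
open Problem public

InQ : Problem → Set
InQ P = ¬ (P ≡ ⟨ min , IS , le ⟩)

FamOf : ∀ {n} → Fam → Matroid n → Subset n → Set
FamOf bases M X = IsBase M X
FamOf IS    M X = IsIndep M X

RelOf : Rel → ℤ → ℤ → Set
RelOf le a b = a ℤ.≤ b
RelOf ge a b = a ℤ.≥ b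

record MOL (n : ℕ) : Set₁ where
  field
    Mat : Matroid n
    v w : Fin n → ℤ
    L   : ℤ
open MOL public

IsSolution : ∀ {n} → Problem → MOL n → Subset n → Set
IsSolution P J S = FamOf (fam P) (Mat J) S × RelOf (rel P) (sumℤ (w J) S) (L J)

d : Problem → ℕ
d ⟨ max , _ , le ⟩ = 0
d ⟨ min , _ , ge ⟩ = 0
d ⟨ max , _ , ge ⟩ = 1
d ⟨ min , _ , le ⟩ = 1

sgn : ℕ → ℤ → ℤ
sgn zero    x = x
sgn (suc k) x = ℤ.- (sgn k x)

H : ∀ {n} → EMB n → ℕ
H {n} I = 2 ℕ.* (1 ⊔ sumℕ (c I) (full n))

vI : ∀ {n} → EMB n → Fin n → ℤ
vI I e = + (H I ℕ.+ c I e)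

wIP : ∀ {n} → EMB n → Problem → Fin n → ℤ
wIP I P e = + H I ℤ.+ sgn (d P) (+ c I e)

kI : ∀ {n} → EMB n → ℕ
kI I = rankE (M I)

LIP : ∀ {n} → EMB n → Problem → ℤ
LIP I P = + (kI I ℕ.* H I) ℤ.+ sgn (d P) (+ T I)

R : ∀ {n} → Problem → EMB n → MOL n
R P I = record { Mat = M I ; v = vI I ; w = wIP I P ; L = LIP I P }

{-# OPTIONS --safe #-}
module Submission where

-- The three problems in 𝒬 with opt = min are (min, bases, ≥), (min, IS, ≥) and (min, bases, ≤).
-- For ≥ we have d(P) = 0, so w coincides with v and the bound is the constraint w(S) ≥ L itself.
-- For (min, bases, ≤) the weights are w = H − c and L = kH − T.  A base S has |S| ≥ k, and
-- w(S) = |S|H − c(S) ≤ kH − T forces c(S) ≥ T, so v(S) = |S|H + c(S) ≥ kH + T.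

open import Defs
open import Data.Nat using (ℕ; _*_)
open import Data.Integer using (ℤ; +_; _≥_; _+_)
open import Data.Fin using (Fin; zero; suc)
open import Data.Fin.Subset using (Subset; inside; outside; ∣_∣)
open import Data.Vec using ([]; _∷_)
open import Data.List using (List; []; _∷_; foldr)
open import Data.Product using (_,_)
open import Relation.Nullary using (yes; no)
open import Data.Empty using (⊥-elim)
open import Relation.Binary.PropositionalEquality using (_≡_; refl; sym; trans; cong; subst)
import Data.Nat as ℕ
import Data.Nat.Properties as ℕ
import Data.Integer as ℤ
import Data.Integer.Properties as ℤ
open import Algebra.Properties.CommutativeSemigroup ℤ.+-commutativeSemigroup using (interchange)
open import Data.Integer.Tactic.RingSolver using (solve-∀)

sumℤ-+ : ∀ {n} (f g : Fin n → ℤ) (S : Subset n) →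
         sumℤ (λ i → f i + g i) S ≡ sumℤ f S + sumℤ g S
sumℤ-+ f g []            = refl
sumℤ-+ f g (inside ∷ S)  rewrite sumℤ-+ (λ i → f (suc i)) (λ i → g (suc i)) S =
  interchange (f zero) (g zero) _ _
sumℤ-+ f g (outside ∷ S) = sumℤ-+ (λ i → f (suc i)) (λ i → g (suc i)) S

sumℤ-neg : ∀ {n} (f : Fin n → ℤ) (S : Subset n) → sumℤ (λ i → ℤ.- f i) S ≡ ℤ.- sumℤ f S
sumℤ-neg f []            = refl
sumℤ-neg f (inside ∷ S)  rewrite sumℤ-neg (λ i → f (suc i)) S =
  sym (ℤ.neg-distrib-+ (f zero) _)
sumℤ-neg f (outside ∷ S) = sumℤ-neg (λ i → f (suc i)) S

sumℤ-const : ∀ {n} (x : ℤ) (S : Subset n) → sumℤ (λ _ → x) S ≡ + ∣ S ∣ ℤ.* x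
sumℤ-const x []            = refl
sumℤ-const x (inside ∷ S)  rewrite sumℤ-const x S = sym (ℤ.suc-* (+ ∣ S ∣) x)
sumℤ-const x (outside ∷ S) = sumℤ-const x S

sumℤ-pos-const : ∀ {n} (m : ℕ) (S : Subset n) → sumℤ (λ _ → + m) S ≡ + (∣ S ∣ * m)
sumℤ-pos-const m S rewrite sumℤ-const (+ m) S = sym (ℤ.pos-* ∣ S ∣ m)

sumℤ-shift : ∀ {n} (m : ℕ) (f : Fin n → ℤ) (S : Subset n) →
             sumℤ (λ i → + m + f i) S ≡ + (∣ S ∣ * m) + sumℤ f S
sumℤ-shift m f S = trans (sumℤ-+ (λ _ → + m) f S) (cong (_+ sumℤ f S) (sumℤ-pos-const m S))

foldr-≤ : ∀ {A : Set} {f : A → ℕ → ℕ} {s : ℕ} →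
          (∀ x r → r ℕ.≤ s → f x r ℕ.≤ s) → (xs : List A) → foldr f 0 xs ℕ.≤ s
foldr-≤ f≤ []       = ℕ.z≤n
foldr-≤ f≤ (x ∷ xs) = f≤ x _ (foldr-≤ f≤ xs)

-- rankE folds a function local to its where block; it is recovered here by unification.
foldr-step : ∀ {A B : Set} {f : A → B → B} {z : B} {xs : List A} {r : B} →
             foldr f z xs ≡ r → A → B → B
foldr-step {f = f} _ = f

rankE-step : ∀ {n} (M : Matroid n) → Subset n → ℕ → ℕ
rankE-step {n} M = foldr-step {z = 0} {xs = allSubsets n} {r = rankE M} refl

rankE-step-≤ : ∀ {n} (M : Matroid n) {s : ℕ} → (∀ Y → Indep M Y → ∣ Y ∣ ℕ.≤ s) →
               ∀ X r → r ℕ.≤ s → rankE-step M X r ℕ.≤ s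
rankE-step-≤ M indep≤ X r r≤s with Indep? M X
... | yes X-indep = ℕ.⊔-lub (indep≤ X X-indep) r≤s
... | no _        = r≤s

rankE-≤ : ∀ {n} (M : Matroid n) {s : ℕ} → (∀ Y → Indep M Y → ∣ Y ∣ ℕ.≤ s) → rankE M ℕ.≤ s
rankE-≤ {n} M indep≤ = foldr-≤ (rankE-step-≤ M indep≤) (allSubsets n)

rankE≤∣base∣ : ∀ {n} (M : Matroid n) {S : Subset n} → IsBase M S → rankE M ℕ.≤ ∣ S ∣
rankE≤∣base∣ M (_ , maximal) = rankE-≤ M maximal

j≤i⇒i-k≤j-l⇒j+l≤i+k : ∀ {i j k l : ℤ} → j ℤ.≤ i → i ℤ.- k ℤ.≤ j ℤ.- l → j + l ℤ.≤ i + k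
j≤i⇒i-k≤j-l⇒j+l≤i+k {i} {j} {k} {l} j≤i i-k≤j-l = begin
  j + l                 ≤⟨ ℤ.+-monoˡ-≤ l j≤i ⟩
  i + l                 ≡⟨ sym (x-y+[y+z]≡x+z i k l) ⟩
  i ℤ.- k + (k + l)     ≤⟨ ℤ.+-monoˡ-≤ (k + l) i-k≤j-l ⟩
  j ℤ.- l + (k + l)     ≡⟨ x-y+[z+y]≡x+z j l k ⟩
  j + k                 ≤⟨ ℤ.+-monoˡ-≤ k j≤i ⟩
  i + k                 ∎
  where
  open ℤ.≤-Reasoning
  x-y+[y+z]≡x+z : ∀ x y z → x ℤ.- y + (y + z) ≡ x + z
  x-y+[y+z]≡x+z = solve-∀
  x-y+[z+y]≡x+z : ∀ x y z → x ℤ.- y + (z + y) ≡ x + z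
  x-y+[z+y]≡x+z = solve-∀

lemma3p6 : {n : ℕ} (I : EMB n) (P : Problem) → InQ P → opt P ≡ min →
           (S : Subset n) → IsSolution P (R P I) S →
           sumℤ (v (R P I)) S ≥ + (kI I * H I) + + T I
lemma3p6 I ⟨ min , IS    , le ⟩ P∈Q refl S _            = ⊥-elim (P∈Q refl)
lemma3p6 I ⟨ min , _     , ge ⟩ _   refl S (_ , w≥L)    = w≥L
lemma3p6 I ⟨ min , bases , le ⟩ _   refl S (base , w≤L) =
  subst (_ ℤ.≤_) (sym v[S]≡)
        (j≤i⇒i-k≤j-l⇒j+l≤i+k {k = C} {l = + T I} kH≤∣S∣H (subst (ℤ._≤ _) w[S]≡ w≤L))
  where
  C ∣S∣H : ℤ
  C    = sumℤ (λ e → + c I e) S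
  ∣S∣H = + (∣ S ∣ * H I)
  kH≤∣S∣H : + (kI I * H I) ℤ.≤ ∣S∣H
  kH≤∣S∣H = ℤ.+≤+ (ℕ.*-monoˡ-≤ (H I) (rankE≤∣base∣ (M I) base))
  v[S]≡ : sumℤ (vI I) S ≡ ∣S∣H + C
  v[S]≡ = sumℤ-shift (H I) (λ e → + c I e) S
  w[S]≡ : sumℤ (wIP I ⟨ min , bases , le ⟩) S ≡ ∣S∣H ℤ.- C
  w[S]≡ = trans (sumℤ-shift (H I) (λ e → ℤ.- (+ c I e)) S)
                (cong (_+_ ∣S∣H) (sumℤ-neg (λ e → + c I e) S))
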